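{- For every integer $n \ge 1$, there exist a positive integer $k$ and a $k$-colourable weakly chordal graph $G$ such that $G$ is not $(k+n)$-mixing, i.e. the $(k+n)$-recolouring graph $\mathcal{R}_{k+n}(G)$ is disconnected.
   Context: All graphs are finite and simple. A $k$-colouring of $G$ is a map $\alpha: V(G) \to \{1,\dots,k\}$ with $\alpha(u) \ne \alpha(v)$ for every edge $uv$. The $k$-recolouring graph $\mathcal{R}_k(G)$ has the $k$-colourings of $G$ as vertices, two colourings being adjacent if they differ on exactly one vertex. $G$ is $k$-mixing if $\mathcal{R}_k(G)$ is connected. A hole is an induced chordless cycle on at least five vertices; an antihole is an induced subgraph whose complement is a hole. A graph is weakly chordal if it contains no hole and no antihole. -}

module Defs where

open import Data.Nat using (ℕ; suc; _+_; _%_; _≤_)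
open import Data.Fin using (Fin; toℕ)
open import Data.Bool using (Bool; true; false)
open import Data.Product using (Σ; ∃; ∃-syntax; _×_; _,_; proj₁)
open import Data.Sum using (_⊎_)
open import Data.Empty using (⊥)
open import Relation.Nullary using (¬_)
open import Relation.Binary.PropositionalEquality using (_≡_; _≢_)
open import Function using (Injective)
open import Function.Bundles using (_⇔_)

record Graph : Set where
  field
    N     : ℕ
    adj   : Fin N → Fin N → Bool
    sym   : ∀ u v → adj u v ≡ adj v u
    irrefl : ∀ v → adj v v ≡ false

open Graph public

Edge : (G : Graph) → Fin (N G) → Fin (N G) → Set
Edge G u v = adj G u v ≡ true

IsColouring : (G : Graph) (k : ℕ) → (Fin (N G) → Fin k) → Set
IsColouring G k α = ∀ u v → Edge G u v → α u ≢ α v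

Colouring : Graph → ℕ → Set
Colouring G k = Σ (Fin (N G) → Fin k) (IsColouring G k)

Colourable : Graph → ℕ → Set
Colourable G k = Colouring G k

RecolAdj : (G : Graph) (k : ℕ) → Colouring G k → Colouring G k → Set
RecolAdj G k α β =
  ∃[ v ] (proj₁ α v ≢ proj₁ β v × (∀ u → u ≢ v → proj₁ α u ≡ proj₁ β u))

-- walks in R_k(G); colourings are equal iff pointwise equal
data Walk (G : Graph) (k : ℕ) : Colouring G k → Colouring G k → Set where
  stop : ∀ {α β} → (∀ v → proj₁ α v ≡ proj₁ β v) → Walk G k α β
  step : ∀ {α β γ} → RecolAdj G k α β → Walk G k β γ → Walk G k α γ

Mixing : Graph → ℕ → Set
Mixing G k = ∀ (α β : Colouring G k) → Walk G k α β

Consec : (m : ℕ) → Fin (5 + m) → Fin (5 + m) → Set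
Consec m i j = (suc (toℕ i) % (5 + m) ≡ toℕ j) ⊎ (suc (toℕ j) % (5 + m) ≡ toℕ i)

Hole : Graph → Set
Hole G = ∃[ m ] Σ (Fin (5 + m) → Fin (N G)) λ c →
  Injective _≡_ _≡_ c × (∀ i j → Edge G (c i) (c j) ⇔ Consec m i j)

Antihole : Graph → Set
Antihole G = ∃[ m ] Σ (Fin (5 + m) → Fin (N G)) λ c →
  Injective _≡_ _≡_ c × (∀ i j → Edge G (c i) (c j) ⇔ (i ≢ j × ¬ Consec m i j))

WeaklyChordal : Graph → Set
WeaklyChordal G = ¬ Hole G × ¬ Antihole G

{-# OPTIONS --safe #-}
-- The 8-vertex gadget H below is weakly chordal and 3-colourable but has a frozen 4-colouring:
-- every vertex sees all three other colours on its neighbours, so no vertex can be recoloured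
-- and the colouring is an isolated vertex of R₄(H). Let G be the join of n copies of H. It is
-- 3n-colourable, and still weakly chordal since the complement of a hole or an antihole is
-- connected, which forces it into a single copy. Giving each copy its own four colours yields a
-- frozen 4n-colouring of G, so R_{3n+n}(G) is disconnected. That H itself contains no hole or
-- antihole is checked by an exhaustive search for induced cycles and their complements.
module Submission where

open import Data.Bool using (Bool; true; false; _∨_)
open import Data.Bool.Properties using (T-≡; ∨-comm)
open import Data.Empty using (⊥-elim)
open import Data.Fin using (Fin; toℕ; fromℕ<; zero; suc; #_; combine; quotient; remainder)
open import Data.Fin.Properties using (_≟_; any?; all?; toℕ-injective; toℕ<n; toℕ-fromℕ<; injective⇒≤; combine-injective; combine-remQuot; remQuot-combine; combine-surjective)
open import Data.List using (List; []; _∷_; length; applyDownFrom)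
open import Data.List.Properties using (length-applyDownFrom)
open import Data.Nat using (ℕ; zero; suc; _+_; _*_; _∸_; _%_; _≤_; _<_; z≤n; s≤s; NonZero)
open import Data.Nat.DivMod using (_mod_; m<n⇒m%n≡m; n%n≡0; m%n%n≡m%n; %-distribˡ-+; %-congˡ; m%n<n)
open import Data.Nat.Properties using (+-comm; *-suc; suc-injective; m≤n⇒m<n∨m≡n; ∸-monoˡ-≤)
open import Data.Product using (Σ; ∃-syntax; _×_; _,_; proj₁; proj₂)
open import Data.Sum using (_⊎_; inj₁; inj₂)
import Data.Sum
import Data.Bool as Bool
import Data.Nat as ℕ
open import Data.Unit using (⊤; tt)
open import Data.Vec using (_∷_; []; lookup)
open import Function using (_∘_; Injective)
open import Function.Bundles using (_⇔_; Equivalence)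
open import Relation.Binary using (Decidable)
open import Relation.Binary.PropositionalEquality using (_≡_; _≢_; refl; sym; trans; cong; cong₂; subst; module ≡-Reasoning)
open import Relation.Nullary using (¬_; Dec; yes; no; does; proof; _×-dec_; ¬?)
open import Relation.Nullary.Decidable using (toWitness; _⊎-dec_; _→-dec_; decidable-stable)
open import Relation.Nullary.Reflects using (det; fromEquivalence)

open import Defs renaming (sym to adj-sym)

≡does : ∀ {b} {P : Set} → (b ≡ true) ⇔ P → (P? : Dec P) → b ≡ does P?
≡does b⇔P P? = det (fromEquivalence (to ∘ T-≡.to) (T-≡.from ∘ from)) (proof P?)
  where open Equivalence b⇔P
        module T-≡ = Equivalence T-≡

Frozen : (G : Graph) (k : ℕ) → (Fin (N G) → Fin k) → Set
Frozen G k α = ∀ v c → c ≢ α v → ∃[ u ] (Edge G v u × α u ≡ c)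

edge⇒≢ : ∀ {G u v} → Edge G u v → u ≢ v
edge⇒≢ {G} {u} u~u refl with () ← trans (sym u~u) (irrefl G u)

isColouring? : ∀ G k (α : Fin (N G) → Fin k) → Dec (IsColouring G k α)
isColouring? G k α = all? λ u → all? λ v → (adj G u v Bool.≟ true) →-dec ¬? (α u ≟ α v)

frozen? : ∀ G k (α : Fin (N G) → Fin k) → Dec (Frozen G k α)
frozen? G k α =
  all? λ v → all? λ c → ¬? (c ≟ α v) →-dec any? λ u → (adj G v u Bool.≟ true) ×-dec (α u ≟ c)

module _ {G : Graph} {k : ℕ} where

  frozen⇒surjective : ∀ {α} → Frozen G k α → Fin (N G) → ∀ c → ∃[ u ] α u ≡ c
  frozen⇒surjective {α} frozen v c with c ≟ α v
  ... | yes c≡αv = v , sym c≡αv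
  ... | no  c≢αv = let u , _ , αu≡c = frozen v c c≢αv in u , αu≡c

  -- The new colour of the recoloured vertex already occurs on one of its neighbours.
  frozen⇒noRecolouring : ∀ {α β} → Frozen G k (proj₁ α) → ¬ RecolAdj G k α β
  frozen⇒noRecolouring {α} {β} frozen (v , αv≢βv , unchanged)
    with u , v~u , αu≡βv ← frozen v (proj₁ β v) (αv≢βv ∘ sym)
    = proj₂ β v u v~u (trans (sym αu≡βv) (unchanged u λ u≡v → edge⇒≢ {G} v~u (sym u≡v)))

  frozen⇒walk-trivial : ∀ {α β} → Frozen G k (proj₁ α) → Walk G k α β → ∀ v → proj₁ α v ≡ proj₁ β v
  frozen⇒walk-trivial     frozen (stop α≗β)           = α≗β
  frozen⇒walk-trivial {α} frozen (step {β = γ} α~γ _) = ⊥-elim (frozen⇒noRecolouring {α} {γ} frozen α~γ)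

  frozen⇒¬mixing : ∀ α β v → Frozen G k (proj₁ α) → proj₁ α v ≢ proj₁ β v → ¬ Mixing G k
  frozen⇒¬mixing α β v frozen αv≢βv mixing = αv≢βv (frozen⇒walk-trivial frozen (mixing α β) v)

InducedCopy : (H : Graph) {L : ℕ} → (Fin L → Fin L → Set) → Set
InducedCopy H {L} R =
  Σ (Fin L → Fin (N H)) λ c → Injective _≡_ _≡_ c × (∀ i j → Edge H (c i) (c j) ⇔ R i j)

-- A partial sequence x₀ … xₖ₋₁ is kept reversed, as xₖ₋₁ ∷ … ∷ x₀, so the head of y ∷ ys
-- sits at position length ys; P prescribes the adjacency between positions.
module Search (H : Graph) (P : ℕ → ℕ → Bool) where

  Consistent : ℕ → Fin (N H) → List (Fin (N H)) → Set
  Consistent k x []       = ⊤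
  Consistent k x (y ∷ ys) = adj H x y ≡ P k (length ys) × Consistent k x ys

  Extendable : ℕ → List (Fin (N H)) → Set
  Extendable zero    ys = ⊤
  Extendable (suc r) ys = ∃[ x ] (Consistent (length ys) x ys × Extendable r (x ∷ ys))

  consistent? : ∀ k x ys → Dec (Consistent k x ys)
  consistent? k x []       = yes tt
  consistent? k x (y ∷ ys) = (adj H x y Bool.≟ P k (length ys)) ×-dec consistent? k x ys

  extendable? : ∀ r ys → Dec (Extendable r ys)
  extendable? zero    ys = yes tt
  extendable? (suc r) ys = any? λ x → consistent? (length ys) x ys ×-dec extendable? r (x ∷ ys)

  module _ (f : ℕ → Fin (N H)) (realises : ∀ i j → adj H (f i) (f j) ≡ P i j) where

    consistent-prefix : ∀ k j → Consistent k (f k) (applyDownFrom f j)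
    consistent-prefix k zero    = tt
    consistent-prefix k (suc j) =
      subst (λ l → adj H (f k) (f j) ≡ P k l) (sym (length-applyDownFrom f j)) (realises k j) ,
      consistent-prefix k j

    extendable-prefix : ∀ r k → Extendable r (applyDownFrom f k)
    extendable-prefix zero    k = tt
    extendable-prefix (suc r) k =
      f k ,
      subst (λ l → Consistent l (f k) (applyDownFrom f k)) (sym (length-applyDownFrom f k))
        (consistent-prefix k k) ,
      extendable-prefix r (suc k)

-- Reading positions modulo L makes the prescribed adjacency hold for all pairs of positions.
modPattern : ∀ {L} .{{_ : NonZero L}} {R : Fin L → Fin L → Set} → Decidable R → ℕ → ℕ → Bool
modPattern {L} R? i j = does (R? (i mod L) (j mod L))

inducedCopy⇒extendable : ∀ {H L} .{{_ : NonZero L}} {R : Fin L → Fin L → Set} (R? : Decidable R) →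
  InducedCopy H R → Search.Extendable H (modPattern R?) L []
inducedCopy⇒extendable {H} {L} R? (c , _ , c-induced) =
  Search.extendable-prefix H (modPattern R?) (λ i → c (i mod L))
    (λ i j → ≡does (c-induced _ _) (R? _ _)) L 0

noInducedCycleFamily : ∀ H {R : ∀ m → Fin (5 + m) → Fin (5 + m) → Set} (R? : ∀ m → Decidable (R m)) →
  (∀ (m : Fin (N H ∸ 4)) → ¬ Search.Extendable H (modPattern (R? (toℕ m))) (5 + toℕ m) []) →
  ¬ (∃[ m ] InducedCopy H (R m))
noInducedCycleFamily H R? noneExtendable (m , copy@(_ , injective , _)) =
  subst (λ m → ¬ Search.Extendable H (modPattern (R? m)) (5 + m) []) (toℕ-fromℕ< m<N∸4)
    (noneExtendable (fromℕ< m<N∸4)) (inducedCopy⇒extendable (R? m) copy)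
  where
  m<N∸4 : m < N H ∸ 4
  m<N∸4 = ∸-monoˡ-≤ 4 (injective⇒≤ injective)

consec? : ∀ m → Decidable (Consec m)
consec? m i j = (suc (toℕ i) % (5 + m) ℕ.≟ toℕ j) ⊎-dec (suc (toℕ j) % (5 + m) ℕ.≟ toℕ i)

AntiConsec : ∀ m → Fin (5 + m) → Fin (5 + m) → Set
AntiConsec m i j = i ≢ j × ¬ Consec m i j

antiConsec? : ∀ m → Decidable (AntiConsec m)
antiConsec? m i j = ¬? (i ≟ j) ×-dec ¬? (consec? m i j)

toℕ-mod : ∀ {L} .{{_ : NonZero L}} (i : Fin L) → toℕ i mod L ≡ i
toℕ-mod i = toℕ-injective (trans (toℕ-fromℕ< _) (m<n⇒m%n≡m (toℕ<n i)))

consec-mod : ∀ m k → Consec m (k mod (5 + m)) (suc k mod (5 + m))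
consec-mod m k = inj₁ (begin
  suc (toℕ (k mod L)) % L     ≡⟨ cong (λ x → suc x % L) (toℕ-fromℕ< (m%n<n k L)) ⟩
  suc (k % L) % L             ≡⟨ %-distribˡ-+ 1 (k % L) L ⟩
  (1 % L + k % L % L) % L     ≡⟨ cong (λ x → (1 % L + x) % L) (m%n%n≡m%n k L) ⟩
  (1 % L + k % L) % L         ≡⟨ %-distribˡ-+ 1 k L ⟨
  suc k % L                   ≡⟨ toℕ-fromℕ< (m%n<n (suc k) L) ⟨
  toℕ (suc k mod L)           ∎)
  where
  open ≡-Reasoning
  L = 5 + m

suc%≡suc⇒≡ : ∀ {a b L} .{{_ : NonZero L}} → a < L → suc a % L ≡ suc b → a ≡ b
suc%≡suc⇒≡ {a} {b} {L} a<L eq with m≤n⇒m<n∨m≡n a<L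
... | inj₁ 1+a<L = suc-injective (trans (sym (m<n⇒m%n≡m 1+a<L)) eq)
... | inj₂ 1+a≡L with () ← trans (sym eq) (trans (%-congˡ 1+a≡L) (n%n≡0 L))

consec-2⇒¬consec-3 : ∀ m (i : Fin (5 + m)) → Consec m i (# 2) → ¬ Consec m i (# 3)
consec-2⇒¬consec-3 m i i~2 i~3 =
  ¬both (Data.Sum.map (suc%≡suc⇒≡ (toℕ<n i)) sym i~2) (Data.Sum.map (suc%≡suc⇒≡ (toℕ<n i)) sym i~3)
  where
  ¬both : ∀ {a} → a ≡ 1 ⊎ a ≡ 3 → ¬ (a ≡ 2 ⊎ a ≡ 4)
  ¬both (inj₁ refl) (inj₁ ())
  ¬both (inj₁ refl) (inj₂ ())
  ¬both (inj₂ refl) (inj₁ ())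
  ¬both (inj₂ refl) (inj₂ ())

module Join (n : ℕ) (H : Graph) where

  copy : Fin (n * N H) → Fin n
  copy = quotient (N H)

  local : Fin (n * N H) → Fin (N H)
  local = remainder {n} (N H)

  joinAdj : Fin (n * N H) → Fin (n * N H) → Bool
  joinAdj u v with copy u ≟ copy v
  ... | yes _ = adj H (local u) (local v)
  ... | no  _ = true

  joinAdj-sym : ∀ u v → joinAdj u v ≡ joinAdj v u
  joinAdj-sym u v with copy u ≟ copy v | copy v ≟ copy u
  ... | yes _   | yes _   = adj-sym H (local u) (local v)
  ... | yes u≡v | no  v≢u = ⊥-elim (v≢u (sym u≡v))
  ... | no  u≢v | yes v≡u = ⊥-elim (u≢v (sym v≡u))
  ... | no  _   | no  _   = refl

  joinAdj-irrefl : ∀ v → joinAdj v v ≡ false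
  joinAdj-irrefl v with copy v ≟ copy v
  ... | yes _   = irrefl H (local v)
  ... | no  v≢v = ⊥-elim (v≢v refl)

  join : Graph
  join = record { N = n * N H ; adj = joinAdj ; sym = joinAdj-sym ; irrefl = joinAdj-irrefl }

  adj-sameCopy : ∀ {u v} → copy u ≡ copy v → joinAdj u v ≡ adj H (local u) (local v)
  adj-sameCopy {u} {v} u≈v with copy u ≟ copy v
  ... | yes _   = refl
  ... | no  u≉v = ⊥-elim (u≉v u≈v)

  edge-otherCopy : ∀ {u v} → copy u ≢ copy v → Edge join u v
  edge-otherCopy {u} {v} u≉v with copy u ≟ copy v
  ... | yes u≈v = ⊥-elim (u≉v u≈v)
  ... | no  _   = refl

  nonEdge⇒sameCopy : ∀ {u v} → ¬ Edge join u v → copy u ≡ copy v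
  nonEdge⇒sameCopy {u} {v} ¬u~v = decidable-stable (copy u ≟ copy v) (¬u~v ∘ edge-otherCopy)

  copy-combine : ∀ i x → copy (combine i x) ≡ i
  copy-combine i x = cong proj₁ (remQuot-combine {n} i x)

  local-combine : ∀ i x → local (combine i x) ≡ x
  local-combine i x = cong proj₂ (remQuot-combine {n} i x)

  copy-local-injective : ∀ {u v} → copy u ≡ copy v → local u ≡ local v → u ≡ v
  copy-local-injective {u} {v} u≈v lu≡lv =
    trans (sym (combine-remQuot {n} (N H) u)) (trans (cong₂ combine u≈v lu≡lv) (combine-remQuot {n} (N H) v))

  liftColours : ∀ {k} → (Fin (N H) → Fin k) → Fin (n * N H) → Fin (n * k)
  liftColours α v = combine (copy v) (α (local v))

  liftColours-combine : ∀ {k} (α : Fin (N H) → Fin k) i x → liftColours α (combine i x) ≡ combine i (α x)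
  liftColours-combine α i x = cong₂ (λ j y → combine j (α y)) (copy-combine i x) (local-combine i x)

  liftColouring : ∀ {k} → Colouring H k → Colouring join (n * k)
  liftColouring (α , proper) = liftColours α , λ u v u~v αu≡αv →
    let u≈v , αlu≡αlv = combine-injective _ _ _ _ αu≡αv
    in proper (local u) (local v) (trans (sym (adj-sameCopy u≈v)) u~v) αlu≡αlv

  -- Colours of v's own palette are supplied by frozenness of H; any other colour occurs in
  -- another copy, all of whose vertices are adjacent to v.
  liftColours-frozen : ∀ {k α} → Frozen H k α → Frozen join (n * k) (liftColours α)
  liftColours-frozen {α = α} frozen v d d≢αv with combine-surjective {n} d
  ... | i , c , ic≡d with i ≟ copy v
  ...   | yes refl =
          let y , lv~y , αy≡c = frozen (local v) c λ { refl → d≢αv (sym ic≡d) }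
          in combine i y ,
             trans (adj-sameCopy (sym (copy-combine i y))) (subst (Edge H (local v)) (sym (local-combine i y)) lv~y) ,
             trans (liftColours-combine α i y) (trans (cong (combine i) αy≡c) ic≡d)
  ...   | no i≉v =
          let y , αy≡c = frozen⇒surjective {G = H} frozen (local v) c
          in combine i y ,
             edge-otherCopy (λ v≈ → i≉v (sym (trans v≈ (copy-combine i y)))) ,
             trans (liftColours-combine α i y) (trans (cong (combine i) αy≡c) ic≡d)

  inducedCopy-fromOneCopy : ∀ {L} {R : Fin L → Fin L → Set} ((c , _ , _) : InducedCopy join R) →
    (∀ i j → copy (c i) ≡ copy (c j)) → InducedCopy H R
  inducedCopy-fromOneCopy (c , injective , induced) oneCopy =
    local ∘ c ,
    (λ {i} {j} → injective ∘ copy-local-injective (oneCopy i j)) ,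
    λ i j → subst (λ b → (b ≡ true) ⇔ _) (adj-sameCopy (oneCopy i j)) (induced i j)

  liftColouring-¬mixing : ∀ {k} (α β : Colouring H k) x → Frozen H k (proj₁ α) → proj₁ α x ≢ proj₁ β x →
    Fin n → ¬ Mixing join (n * k)
  liftColouring-¬mixing α@(αf , _) β@(βf , _) x frozen αx≢βx i =
    frozen⇒¬mixing (liftColouring α) (liftColouring β) (combine i x) (liftColours-frozen frozen)
      λ eq → αx≢βx (proj₂ (combine-injective i (αf x) i (βf x)
        (trans (sym (liftColours-combine αf i x)) (trans eq (liftColours-combine βf i x)))))

  -- Non-consecutive vertices of a hole are non-adjacent, hence in one copy; positions 2 and 3
  -- are both non-consecutive to 0, and every position is non-consecutive to one of them.
  hole⇒hole : Hole join → Hole H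
  hole⇒hole (m , hole@(c , _ , induced)) =
    m , inducedCopy-fromOneCopy hole λ i j → trans (inCopy₀ i) (sym (inCopy₀ j))
    where
    nonConsec⇒sameCopy : ∀ i j → ¬ Consec m i j → copy (c i) ≡ copy (c j)
    nonConsec⇒sameCopy i j ¬i~j = nonEdge⇒sameCopy (¬i~j ∘ Equivalence.to (induced i j))

    inCopy₀ : ∀ i → copy (c i) ≡ copy (c zero)
    inCopy₀ i with consec? m i (# 2)
    ... | no ¬i~2 = trans (nonConsec⇒sameCopy i (# 2) ¬i~2) (nonConsec⇒sameCopy (# 2) zero λ { (inj₁ ()) ; (inj₂ ()) })
    ... | yes i~2 = trans (nonConsec⇒sameCopy i (# 3) (consec-2⇒¬consec-3 m i i~2))
                          (nonConsec⇒sameCopy (# 3) zero λ { (inj₁ ()) ; (inj₂ ()) })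

  -- Consecutive vertices of an antihole are non-adjacent, hence in one copy.
  antihole⇒antihole : Antihole join → Antihole H
  antihole⇒antihole (m , antihole@(c , _ , induced)) =
    m , inducedCopy-fromOneCopy antihole λ i j → trans (inCopy₀ i) (sym (inCopy₀ j))
    where
    inCopy₀-mod : ∀ k → copy (c (k mod (5 + m))) ≡ copy (c zero)
    inCopy₀-mod zero    = refl
    inCopy₀-mod (suc k) =
      trans (sym (nonEdge⇒sameCopy λ e → proj₂ (Equivalence.to (induced _ _) e) (consec-mod m k)))
            (inCopy₀-mod k)

    inCopy₀ : ∀ i → copy (c i) ≡ copy (c zero)
    inCopy₀ i = subst (λ j → copy (c j) ≡ copy (c zero)) (toℕ-mod i) (inCopy₀-mod (toℕ i))

  weaklyChordal : WeaklyChordal H → WeaklyChordal join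
  weaklyChordal (noHole , noAntihole) = noHole ∘ hole⇒hole , noAntihole ∘ antihole⇒antihole

gadgetEdge : ℕ → ℕ → Bool
gadgetEdge 0 3 = true
gadgetEdge 0 5 = true
gadgetEdge 0 6 = true
gadgetEdge 1 2 = true
gadgetEdge 1 4 = true
gadgetEdge 1 5 = true
gadgetEdge 1 6 = true
gadgetEdge 1 7 = true
gadgetEdge 2 5 = true
gadgetEdge 2 6 = true
gadgetEdge 3 4 = true
gadgetEdge 3 5 = true
gadgetEdge 3 6 = true
gadgetEdge 3 7 = true
gadgetEdge 4 6 = true
gadgetEdge 5 7 = true
gadgetEdge _ _ = false

gadget : Graph
gadget = record
  { N      = 8
  ; adj    = λ x y → gadgetEdge (toℕ x) (toℕ y) ∨ gadgetEdge (toℕ y) (toℕ x)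
  ; sym    = λ x y → ∨-comm (gadgetEdge (toℕ x) (toℕ y)) (gadgetEdge (toℕ y) (toℕ x))
  ; irrefl = toWitness {a? = all? λ x → gadgetEdge (toℕ x) (toℕ x) ∨ gadgetEdge (toℕ x) (toℕ x) Bool.≟ false} _
  }

gadget-weaklyChordal : WeaklyChordal gadget
gadget-weaklyChordal =
  noInducedCycleFamily gadget consec?
    (toWitness {a? = all? λ m →
      ¬? (Search.extendable? gadget (modPattern (consec? (toℕ m))) (5 + toℕ m) [])} _) ,
  noInducedCycleFamily gadget antiConsec?
    (toWitness {a? = all? λ m →
      ¬? (Search.extendable? gadget (modPattern (antiConsec? (toℕ m))) (5 + toℕ m) [])} _)

gadget-3colouring : Colouring gadget 3
gadget-3colouring =
  lookup (# 0 ∷ # 1 ∷ # 0 ∷ # 1 ∷ # 0 ∷ # 2 ∷ # 2 ∷ # 0 ∷ []) ,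
  toWitness {a? = isColouring? gadget 3 _} _

gadget-frozen4colouring : Colouring gadget 4
gadget-frozen4colouring =
  lookup (# 0 ∷ # 0 ∷ # 1 ∷ # 1 ∷ # 2 ∷ # 2 ∷ # 3 ∷ # 3 ∷ []) ,
  toWitness {a? = isColouring? gadget 4 _} _

gadget-frozen : Frozen gadget 4 (proj₁ gadget-frozen4colouring)
gadget-frozen = toWitness {a? = frozen? gadget 4 _} _

gadget-swapped4colouring : Colouring gadget 4
gadget-swapped4colouring =
  lookup (# 1 ∷ # 1 ∷ # 0 ∷ # 0 ∷ # 2 ∷ # 2 ∷ # 3 ∷ # 3 ∷ []) ,
  toWitness {a? = isColouring? gadget 4 _} _

theorem1 : ∀ (n : ℕ) → 1 ≤ n →
    ∃[ k ] (1 ≤ k × Σ Graph λ G →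
      Colourable G k × WeaklyChordal G × ¬ Mixing G (k + n))
theorem1 n@(suc _) _ =
  n * 3 , s≤s z≤n , join ,
  liftColouring gadget-3colouring ,
  weaklyChordal gadget-weaklyChordal ,
  subst (¬_ ∘ Mixing join) n*4≡n*3+n
    (liftColouring-¬mixing gadget-frozen4colouring gadget-swapped4colouring zero gadget-frozen (λ ()) zero)
  where
  open Join n gadget
  n*4≡n*3+n : n * 4 ≡ n * 3 + n
  n*4≡n*3+n = trans (*-suc n 3) (+-comm n (n * 3))
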